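{- Let $n\ge 2$, and for each $s=1,\dots,n$ let $k_s\ge1$ and $L_s=([a_1^s,b_1^s],\dots,[a_{k_s}^s,b_{k_s}^s])$ be a sequence of intervals with nonnegative integer endpoints such that $a_1^s\ge a_2^s\ge\cdots\ge a_{k_s}^s$. Suppose that for every $m\in\{1,\dots,n\}$ and every $r$ with $1\le r\le k_m$, $$\sum_{i=1}^{r}\Big\lceil\frac{a_i^m}{n-1}\Big\rceil\le\min\Big\{\sum_{j=1}^{k_s}\min\Big\{\Big\lfloor\frac{a_j^s}{n-1}\Big\rfloor,r\Big\}\;:\;s\in\{1,\dots,n\},\ s\ne m\Big\}.$$ Then $(L_1;\dots;L_n)$ is realizable by an $n$-partite graph, i.e. there exists a simple $n$-partite graph $G$ with vertex classes $X_s=\{x_1^s,\dots,x_{k_s}^s\}$ ($s=1,\dots,n$) such that $a_i^s\le d_G(x_i^s)\le b_i^s$ for all $s$ and $1\le i\le k_s$.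
   Context: An $n$-partite graph is a simple graph whose vertex set is partitioned into $n$ classes with no edge joining two vertices of the same class. $d_G(v)$ denotes the degree of $v$ in $G$. -}

module Defs where

open import Data.Nat using (ℕ; zero; suc; _+_; _∸_; _≤_; _⊓_; NonZero; s≤s; z≤n)
open import Data.Nat.DivMod using (_/_)
open import Data.Fin using (Fin; zero; suc)
open import Data.Bool using (Bool; true; false; if_then_else_)
open import Data.Product using (Σ; _×_; _,_; proj₁; proj₂)
open import Relation.Binary.PropositionalEquality using (_≡_)

sumFin : (k : ℕ) → (Fin k → ℕ) → ℕ
sumFin zero    f = 0
sumFin (suc k) f = f zero + sumFin k (λ i → f (suc i))

-- ∑_{i=1}^{r} f i (first r terms, truncated at k), indices 0-based
sumFirst : (k : ℕ) → ℕ → (Fin k → ℕ) → ℕ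
sumFirst zero    r       f = 0
sumFirst (suc k) zero    f = 0
sumFirst (suc k) (suc r) f = f zero + sumFirst k r (λ i → f (suc i))

⌊_/_⌋ : ℕ → (d : ℕ) → .{{NonZero d}} → ℕ
⌊ a / d ⌋ = a / d

⌈_/_⌉ : ℕ → (d : ℕ) → .{{NonZero d}} → ℕ
⌈ a / d ⌉ = (a + (d ∸ 1)) / d

nz : {n : ℕ} → 2 ≤ n → NonZero (n ∸ 1)
nz {suc (suc n)} (s≤s (s≤s _)) = _

-- vertices of the n-partite vertex set: x_i^s is (s , i)
Vertex : (n : ℕ) → (k : Fin n → ℕ) → Set
Vertex n k = Σ (Fin n) (λ s → Fin (k s))

-- a simple n-partite graph on classes X_s = {x_i^s}: a symmetric Bool-valued
-- adjacency with no edge inside a class (hence loopless)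
record NPartiteGraph (n : ℕ) (k : Fin n → ℕ) : Set where
  field
    adj       : Vertex n k → Vertex n k → Bool
    symmetric : ∀ u v → adj u v ≡ adj v u
    partite   : ∀ u v → proj₁ u ≡ proj₁ v → adj u v ≡ false

degree : {n : ℕ} {k : Fin n → ℕ} → NPartiteGraph n k → Vertex n k → ℕ
degree {n} {k} G v =
  sumFin n (λ t → sumFin (k t) (λ j →
    if NPartiteGraph.adj G v (t , j) then 1 else 0))

{-# OPTIONS --safe #-}
-- Taking r = k_m, the hypothesis gives Σ_i ⌈a_i^m/(n-1)⌉ ≤ Σ_j ⌊a_j^s/(n-1)⌋ for any
-- two classes m ≠ s; chaining it through a second class squeezes all these sums
-- together, so every a_i^s is divisible by n-1 and the quotients f_s = a^s/(n-1)
-- have the same total in every class. For each pair of classes s < t the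
-- hypothesis is then exactly the Gale–Ryser condition for the degree sequences
-- f_s and f_t, so there is a bipartite graph between X_s and X_t realising them.
-- The union of these n(n-1)/2 bipartite graphs gives every vertex degree
-- (n-1) f_s(i) = a_i^s. Gale–Ryser is proved by the usual greedy step: join the
-- largest row to the columns with the largest positive demands and recurse.
module Submission where

open import Defs
open import Data.Nat using (ℕ; zero; suc; _+_; _*_; _∸_; _⊓_; _≤_; _≥_; z≤n; s≤s; _≤?_; _<?_)
open import Data.Nat.DivMod using (_/_; _%_; m≡m%n+[m/n]*n; m%n<n; m/n*n≤m; /-monoˡ-≤)
open import Data.Nat.Properties
open import Algebra.Properties.CommutativeSemigroup +-commutativeSemigroup using (interchange)
open import Data.Bool as Bool using (Bool; true; false; if_then_else_; _∨_)
open import Data.Fin using (Fin; zero; suc; toℕ; punchIn)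
import Data.Fin as Fin
import Data.Fin.Properties as Fin
open import Data.Empty using (⊥-elim)
open import Data.Product using (Σ; ∃-syntax; _×_; _,_; proj₁)
open import Data.Sum using (_⊎_; inj₁; inj₂)
open import Function using (_∘_)
open import Level using (0ℓ)
open import Relation.Binary.Core using (_Preserves_⟶_)
open import Relation.Binary.Definitions using (tri<; tri≈; tri>)
open import Relation.Binary.PropositionalEquality
  using (_≡_; _≢_; refl; sym; trans; cong; cong₂; subst; module ≡-Reasoning)
open import Relation.Nullary using (¬_; yes; no; does)
open import Relation.Nullary.Decidable using (_×-dec_)
open import Relation.Unary using (Pred; Decidable)

sumFin-cong : ∀ {k} {f g : Fin k → ℕ} → (∀ i → f i ≡ g i) → sumFin k f ≡ sumFin k g
sumFin-cong {zero}  f≗g = refl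
sumFin-cong {suc k} f≗g = cong₂ _+_ (f≗g zero) (sumFin-cong (f≗g ∘ suc))

sumFin-mono-≤ : ∀ {k} {f g : Fin k → ℕ} → (∀ i → f i ≤ g i) → sumFin k f ≤ sumFin k g
sumFin-mono-≤ {zero}  f≤g = z≤n
sumFin-mono-≤ {suc k} f≤g = +-mono-≤ (f≤g zero) (sumFin-mono-≤ (f≤g ∘ suc))

sumFin-distrib-+ : ∀ {k} (f g : Fin k → ℕ) →
                   sumFin k (λ i → f i + g i) ≡ sumFin k f + sumFin k g
sumFin-distrib-+ {zero}  f g = refl
sumFin-distrib-+ {suc k} f g =
  trans (cong (f zero + g zero +_) (sumFin-distrib-+ (f ∘ suc) (g ∘ suc)))
        (interchange (f zero) (g zero) _ _)

sumFin-distribʳ-* : ∀ {k} (f : Fin k → ℕ) c → sumFin k (λ i → f i * c) ≡ sumFin k f * c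
sumFin-distribʳ-* {zero}  f c = refl
sumFin-distribʳ-* {suc k} f c =
  trans (cong (f zero * c +_) (sumFin-distribʳ-* (f ∘ suc) c))
        (sym (*-distribʳ-+ c (f zero) _))

sumFin-const : ∀ k {f : Fin k → ℕ} {c} → (∀ i → f i ≡ c) → sumFin k f ≡ k * c
sumFin-const zero    f≗c = refl
sumFin-const (suc k) f≗c = cong₂ _+_ (f≗c zero) (sumFin-const k (f≗c ∘ suc))

sumFin-except : ∀ {d} (h : Fin (suc d) → ℕ) s {c} →
                h s ≡ 0 → (∀ t → t ≢ s → h t ≡ c) → sumFin (suc d) h ≡ d * c
sumFin-except h zero    hs≡0 h≗c = cong₂ _+_ hs≡0 (sumFin-const _ λ t → h≗c (suc t) λ ())
sumFin-except {suc d} h (suc s) hs≡0 h≗c =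
  cong₂ _+_ (h≗c zero λ ())
            (sumFin-except (h ∘ suc) s hs≡0 λ t t≢s → h≗c (suc t) (t≢s ∘ Fin.suc-injective))

sumFin≡0⇒≡0 : ∀ {k} (f : Fin k → ℕ) → sumFin k f ≡ 0 → ∀ i → f i ≡ 0
sumFin≡0⇒≡0 f Σ≡0 zero    = m+n≡0⇒m≡0 (f zero) Σ≡0
sumFin≡0⇒≡0 f Σ≡0 (suc i) = sumFin≡0⇒≡0 (f ∘ suc) (m+n≡0⇒n≡0 (f zero) Σ≡0) i

pointwise-≡-from-sumFin : ∀ {k} {f g : Fin k → ℕ} → (∀ i → f i ≤ g i) →
                          sumFin k g ≤ sumFin k f → ∀ i → f i ≡ g i
pointwise-≡-from-sumFin {suc k} {f} {g} f≤g Σg≤Σf zero =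
  ≤-antisym (f≤g zero)
    (+-cancelʳ-≤ _ _ _ (≤-trans Σg≤Σf (+-monoʳ-≤ (f zero) (sumFin-mono-≤ (f≤g ∘ suc)))))
pointwise-≡-from-sumFin {suc k} {f} {g} f≤g Σg≤Σf (suc i) =
  pointwise-≡-from-sumFin (f≤g ∘ suc)
    (+-cancelˡ-≤ (g zero) _ _ (≤-trans Σg≤Σf (+-monoˡ-≤ _ (f≤g zero)))) i

sumFirst-zero : ∀ k (f : Fin k → ℕ) → sumFirst k 0 f ≡ 0
sumFirst-zero zero    f = refl
sumFirst-zero (suc k) f = refl

sumFirst-all : ∀ k (f : Fin k → ℕ) → sumFirst k k f ≡ sumFin k f
sumFirst-all zero    f = refl
sumFirst-all (suc k) f = cong (f zero +_) (sumFirst-all k (f ∘ suc))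

sumFirst-cong : ∀ k r {f g : Fin k → ℕ} → (∀ i → f i ≡ g i) → sumFirst k r f ≡ sumFirst k r g
sumFirst-cong zero    r       f≗g = refl
sumFirst-cong (suc k) zero    f≗g = refl
sumFirst-cong (suc k) (suc r) f≗g = cong₂ _+_ (f≗g zero) (sumFirst-cong k r (f≗g ∘ suc))

sumFirst-≤-* : ∀ k r {f : Fin k → ℕ} {c} → (∀ i → f i ≤ c) → sumFirst k r f ≤ r * c
sumFirst-≤-* zero    r       f≤c = z≤n
sumFirst-≤-* (suc k) zero    f≤c = z≤n
sumFirst-≤-* (suc k) (suc r) f≤c = +-mono-≤ (f≤c zero) (sumFirst-≤-* k r (f≤c ∘ suc))

⌈/⌉≤⌊/⌋⇒exact : ∀ a d → ⌈ a / suc d ⌉ ≤ ⌊ a / suc d ⌋ → suc d * ⌊ a / suc d ⌋ ≡ a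
⌈/⌉≤⌊/⌋⇒exact a d ⌈⌉≤⌊⌋ = trans (*-comm (suc d) q) (≤-antisym (m/n*n≤m a (suc d)) a≤q*D)
  where
  q : ℕ
  q = a / suc d
  bound : suc (d + a) ≤ suc (d + q * suc d)
  bound = begin
    suc (d + a)                                     ≡⟨ cong suc (+-comm d a) ⟩
    suc (a + d)                                     ≡⟨ cong suc (m≡m%n+[m/n]*n (a + d) (suc d)) ⟩
    suc ((a + d) % suc d + (a + d) / suc d * suc d) ≤⟨ +-monoˡ-≤ _ (m%n<n (a + d) (suc d)) ⟩
    suc d + (a + d) / suc d * suc d                 ≤⟨ +-monoʳ-≤ (suc d) (*-monoˡ-≤ (suc d) ⌈⌉≤⌊⌋) ⟩
    suc (d + q * suc d)                             ∎
    where open ≤-Reasoning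
  a≤q*D : a ≤ q * suc d
  a≤q*D = +-cancelˡ-≤ d _ _ (≤-pred bound)

bit : Bool → ℕ
bit b = if b then 1 else 0

count : ∀ {l} → (Fin l → Bool) → ℕ
count {l} B = sumFin l (λ j → bit (B j))

insert : ∀ {l} → Fin l → (Fin l → Bool) → Fin l → Bool
insert j B j′ = does (j′ Fin.≟ j) ∨ B j′

insert-true : ∀ {l} (j : Fin l) B j′ → insert j B j′ ≡ true → j′ ≡ j ⊎ B j′ ≡ true
insert-true j B j′ B′j′ with j′ Fin.≟ j
... | yes j′≡j = inj₁ j′≡j
... | no  _    = inj₂ B′j′

insert-false : ∀ {l} (j : Fin l) B j′ → insert j B j′ ≡ false → B j′ ≡ false
insert-false j B j′ B′j′ with j′ Fin.≟ j
insert-false _ _ _ () | yes _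
... | no _ = B′j′

count-insert : ∀ {l} (j : Fin l) {B} → B j ≡ false → count (insert j B) ≡ suc (count B)
count-insert {suc l} zero    {B} Bj≡false rewrite Bj≡false = refl
count-insert {suc l} (suc j) {B} Bj≡false =
  trans (cong (bit (B zero) +_) (count-insert j Bj≡false)) (+-suc (bit (B zero)) _)

argmax : ∀ {l} {P : Pred (Fin l) 0ℓ} → Decidable P → (q : Fin l → ℕ) →
         (∀ j → ¬ P j) ⊎ ∃[ j ] P j × (∀ {j′} → P j′ → q j′ ≤ q j)
argmax {zero}  P? q = inj₁ λ ()
argmax {suc l} P? q with argmax (P? ∘ suc) (q ∘ suc) | P? zero
... | inj₁ none | no ¬p₀ = inj₁ λ { zero → ¬p₀ ; (suc j) → none j }
... | inj₁ none | yes p₀ =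
  inj₂ (zero , p₀ , λ { {zero} _ → ≤-refl ; {suc j′} pj′ → ⊥-elim (none j′ pj′) })
... | inj₂ (j , pj , max) | no ¬p₀ =
  inj₂ (suc j , pj , λ { {zero} p₀ → ⊥-elim (¬p₀ p₀) ; {suc j′} pj′ → max pj′ })
... | inj₂ (j , pj , max) | yes p₀ with q (suc j) ≤? q zero
...   | yes qj≤q₀ =
  inj₂ (zero , p₀ , λ { {zero} _ → ≤-refl ; {suc j′} pj′ → ≤-trans (max pj′) qj≤q₀ })
...   | no  qj≰q₀ =
  inj₂ (suc j , pj , λ { {zero} _ → <⇒≤ (≰⇒> qj≰q₀) ; {suc j′} pj′ → max pj′ })

record TopSet {l} (q : Fin l → ℕ) (c : ℕ) : Set where
  field
    chosen   : Fin l → Bool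
    size     : count chosen ≡ c
    positive : ∀ j → chosen j ≡ true → 1 ≤ q j
    top      : ∀ j j′ → chosen j ≡ true → chosen j′ ≡ false → q j′ ≤ q j

module _ {l} {q : Fin l → ℕ} {c} (T : TopSet q c) where
  open TopSet T

  Available : Pred (Fin l) 0ℓ
  Available j = chosen j ≡ false × 1 ≤ q j

  available? : Decidable Available
  available? j = (chosen j Bool.≟ false) ×-dec (1 ≤? q j)

  count-unavailable : (∀ j → ¬ Available j) → sumFin l (λ j → q j ⊓ 1) ≤ count chosen
  count-unavailable none = sumFin-mono-≤ q⊓1≤bit
    where
    q⊓1≤bit : ∀ j → q j ⊓ 1 ≤ bit (chosen j)
    q⊓1≤bit j with chosen j in e | 1 ≤? q j
    ... | true  | _       = m⊓n≤n (q j) 1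
    ... | false | yes 1≤q = ⊥-elim (none j (e , 1≤q))
    ... | false | no  1≰q = ≤-trans (m⊓n≤m (q j) 1) (≤-pred (≰⇒> 1≰q))

  extendTopSet : suc c ≤ sumFin l (λ j → q j ⊓ 1) → TopSet q (suc c)
  extendTopSet c<Σ with argmax available? q
  ... | inj₁ none = ⊥-elim (<⇒≱ c<Σ (≤-trans (count-unavailable none) (≤-reflexive size)))
  ... | inj₂ (j* , (j*∉ , 1≤qj*) , max) = record
    { chosen   = insert j* chosen
    ; size     = trans (count-insert j* j*∉) (cong suc size)
    ; positive = positive′
    ; top      = top′
    }
    where
    positive′ : ∀ j → insert j* chosen j ≡ true → 1 ≤ q j
    positive′ j j∈ with insert-true j* chosen j j∈
    ... | inj₁ refl = 1≤qj*
    ... | inj₂ j∈′  = positive j j∈′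
    top′ : ∀ j j′ → insert j* chosen j ≡ true → insert j* chosen j′ ≡ false → q j′ ≤ q j
    top′ j j′ j∈ j′∉ with insert-true j* chosen j j∈ | 1 ≤? q j′
    ... | inj₂ j∈′  | _       = top j j′ j∈′ (insert-false j* chosen j′ j′∉)
    ... | inj₁ refl | yes 1≤q = max (insert-false j* chosen j′ j′∉ , 1≤q)
    ... | inj₁ refl | no  1≰q = ≤-trans (≤-pred (≰⇒> 1≰q)) z≤n

topSet : ∀ {l} (q : Fin l → ℕ) c → c ≤ sumFin l (λ j → q j ⊓ 1) → TopSet q c
topSet {l} q zero    _   = record
  { chosen   = λ _ → false
  ; size     = trans (sumFin-const l {c = 0} λ _ → refl) (*-zeroʳ l)
  ; positive = λ _ ()
  ; top      = λ _ _ ()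
  }
topSet     q (suc c) c<Σ = extendTopSet (topSet q c (<⇒≤ c<Σ)) c<Σ

record BipartiteRealization {k l} (p : Fin k → ℕ) (q : Fin l → ℕ) : Set where
  field
    edge       : Fin k → Fin l → Bool
    row-degree : ∀ i → count (edge i) ≡ p i
    col-degree : ∀ j → count (λ i → edge i j) ≡ q j

Antitone : ∀ {k} → (Fin k → ℕ) → Set
Antitone p = p Preserves Fin._≤_ ⟶ _≥_

record GaleRyser {k l} (p : Fin k → ℕ) (q : Fin l → ℕ) : Set where
  field
    sumFirst≤ : ∀ r → r ≤ k → sumFirst k r p ≤ sumFin l (λ j → q j ⊓ r)

open GaleRyser

GaleRyser-from-positive : ∀ {k l} {p : Fin k → ℕ} {q : Fin l → ℕ} →
  (∀ r → 1 ≤ r → r ≤ k → sumFirst k r p ≤ sumFin l (λ j → q j ⊓ r)) → GaleRyser p q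
sumFirst≤ (GaleRyser-from-positive {k} {p = p} _) zero    _   =
  ≤-trans (≤-reflexive (sumFirst-zero k p)) z≤n
sumFirst≤ (GaleRyser-from-positive H) (suc r) r≤k = H (suc r) (s≤s z≤n) r≤k

GaleRyser-congˡ : ∀ {k l} {p p′ : Fin k → ℕ} {q : Fin l → ℕ} →
                  (∀ i → p i ≡ p′ i) → GaleRyser p q → GaleRyser p′ q
sumFirst≤ (GaleRyser-congˡ {k} p≗p′ gr) r r≤k =
  subst (_≤ _) (sumFirst-cong k r p≗p′) (sumFirst≤ gr r r≤k)

GaleRyser⇒sumFin-≤ : ∀ {k l} {p : Fin k → ℕ} {q : Fin l → ℕ} → GaleRyser p q →
                     sumFin k p ≤ sumFin l q
GaleRyser⇒sumFin-≤ {k} {l} {p} {q} gr = begin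
  sumFin k p                   ≡⟨ sumFirst-all k p ⟨
  sumFirst k k p               ≤⟨ sumFirst≤ gr k ≤-refl ⟩
  sumFin l (λ j → q j ⊓ k)     ≤⟨ sumFin-mono-≤ (λ j → m⊓n≤m (q j) k) ⟩
  sumFin l q                   ∎
  where open ≤-Reasoning

module Residual {k l} {p : Fin (suc k) → ℕ} {q : Fin l → ℕ} (T : TopSet q (p zero)) where
  open TopSet T

  q′ : Fin l → ℕ
  q′ j = q j ∸ bit (chosen j)

  bit+q′≡q : ∀ j → bit (chosen j) + q′ j ≡ q j
  bit+q′≡q j with chosen j in e
  ... | true  = m+[n∸m]≡n (positive j e)
  ... | false = refl

  sumFin-q′ : sumFin l q ≡ p zero + sumFin l q′
  sumFin-q′ = begin
    sumFin l q                                ≡⟨ sumFin-cong bit+q′≡q ⟨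
    sumFin l (λ j → bit (chosen j) + q′ j)    ≡⟨ sumFin-distrib-+ (bit ∘ chosen) q′ ⟩
    count chosen + sumFin l q′                ≡⟨ cong (_+ sumFin l q′) size ⟩
    p zero + sumFin l q′                      ∎
    where open ≡-Reasoning

  ⊓-suc-split : ∀ {r} → (∀ j → chosen j ≡ false → q j ≤ r) →
                ∀ j → q j ⊓ suc r ≡ bit (chosen j) + q′ j ⊓ r
  ⊓-suc-split unchosen≤r j with chosen j in e
  ... | true with q j | positive j e
  ...   | suc _ | _ = refl
  ⊓-suc-split unchosen≤r j | false =
    trans (m≤n⇒m⊓n≡m (m≤n⇒m≤1+n (unchosen≤r j e))) (sym (m≤n⇒m⊓n≡m (unchosen≤r j e)))

  -- If an unchosen column still demands more than r, every chosen column keeps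
  -- at least r, which covers the first r rows since none exceeds p zero; otherwise
  -- the condition for p at r + 1 turns into the condition for q′ at r.
  residual-GaleRyser : Antitone p → GaleRyser p q → GaleRyser (p ∘ suc) q′
  sumFirst≤ (residual-GaleRyser anti gr) r r≤k
    with Fin.any? (λ j → (chosen j Bool.≟ false) ×-dec (r <? q j))
  ... | yes (j₀ , j₀∉ , r<qj₀) = begin
    sumFirst k r (p ∘ suc)                   ≤⟨ sumFirst-≤-* k r (λ _ → anti z≤n) ⟩
    r * p zero                               ≡⟨ *-comm r (p zero) ⟩
    p zero * r                               ≡⟨ cong (_* r) size ⟨
    count chosen * r                         ≡⟨ sumFin-distribʳ-* (bit ∘ chosen) r ⟨
    sumFin l (λ j → bit (chosen j) * r)      ≤⟨ sumFin-mono-≤ chosen⇒r≤q′ ⟩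
    sumFin l (λ j → q′ j ⊓ r)                ∎
    where
    open ≤-Reasoning
    chosen⇒r≤q′ : ∀ j → bit (chosen j) * r ≤ q′ j ⊓ r
    chosen⇒r≤q′ j with chosen j in e
    ... | false = z≤n
    ... | true  = ≤-reflexive (trans (*-identityˡ r) (sym (m≥n⇒m⊓n≡n r≤qj∸1)))
      where r≤qj∸1 : r ≤ q j ∸ 1
            r≤qj∸1 = ∸-monoˡ-≤ 1 (≤-trans r<qj₀ (top j j₀ e j₀∉))
  ... | no none = +-cancelˡ-≤ (p zero) _ _ (begin
    sumFirst (suc k) (suc r) p                ≤⟨ sumFirst≤ gr (suc r) (s≤s r≤k) ⟩
    sumFin l (λ j → q j ⊓ suc r)              ≡⟨ sumFin-cong (⊓-suc-split unchosen≤r) ⟩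
    sumFin l (λ j → bit (chosen j) + q′ j ⊓ r) ≡⟨ sumFin-distrib-+ (bit ∘ chosen) (λ j → q′ j ⊓ r) ⟩
    count chosen + sumFin l (λ j → q′ j ⊓ r)  ≡⟨ cong (_+ sumFin l (λ j → q′ j ⊓ r)) size ⟩
    p zero + sumFin l (λ j → q′ j ⊓ r)        ∎)
    where
    open ≤-Reasoning
    unchosen≤r : ∀ j → chosen j ≡ false → q j ≤ r
    unchosen≤r j e = ≮⇒≥ λ r<qj → none (j , e , r<qj)

gale-ryser : ∀ {k l} {p : Fin k → ℕ} {q : Fin l → ℕ} → Antitone p →
             sumFin k p ≡ sumFin l q → GaleRyser p q → BipartiteRealization p q
gale-ryser {zero} {q = q} _ Σp≡Σq _ = record
  { edge       = λ ()
  ; row-degree = λ ()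
  ; col-degree = λ j → sym (sumFin≡0⇒≡0 q (sym Σp≡Σq) j)
  }
gale-ryser {suc k} {l} {p} {q} anti Σp≡Σq gr = record
  { edge       = edge
  ; row-degree = row-degree
  ; col-degree = λ j → trans (cong (bit (chosen j) +_) (R.col-degree j)) (bit+q′≡q j)
  }
  where
  T : TopSet q (p zero)
  T = topSet q (p zero) (≤-trans (m≤m+n (p zero) _) (sumFirst≤ gr 1 (s≤s z≤n)))
  open TopSet T
  open Residual {p = p} T
  module R = BipartiteRealization
    (gale-ryser {q = q′} (anti ∘ s≤s) (+-cancelˡ-≡ (p zero) _ _ (trans Σp≡Σq sumFin-q′))
                (residual-GaleRyser anti gr))
  edge : Fin (suc k) → Fin l → Bool
  edge zero    = chosen
  edge (suc i) = R.edge i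
  row-degree : ∀ i → count (edge i) ≡ p i
  row-degree zero    = size
  row-degree (suc i) = R.row-degree i

module _ {n} {k : Fin n → ℕ} {f g : (s : Fin n) → Fin (k s) → ℕ}
         (f≤g : ∀ s i → f s i ≤ g s i)
         (Σg≤Σf : ∀ s t → t ≢ s → sumFin (k s) (g s) ≤ sumFin (k t) (f t)) where

  class-sums-≡ : ∀ s t → t ≢ s → sumFin (k s) (f s) ≡ sumFin (k t) (f t)
  class-sums-≡ s t t≢s = ≤-antisym
    (≤-trans (sumFin-mono-≤ (f≤g s)) (Σg≤Σf s t t≢s))
    (≤-trans (sumFin-mono-≤ (f≤g t)) (Σg≤Σf t s (t≢s ∘ sym)))

  squeeze : ∀ s → ∃[ t ] t ≢ s → ∀ i → f s i ≡ g s i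
  squeeze s (t , t≢s) = pointwise-≡-from-sumFin (f≤g s)
    (≤-trans (Σg≤Σf s t t≢s) (≤-reflexive (sym (class-sums-≡ s t t≢s))))

module _ {d} {k : Fin (suc d) → ℕ} (f : (s : Fin (suc d)) → Fin (k s) → ℕ)
         (realize : ∀ {s t} → s Fin.< t → BipartiteRealization (f s) (f t)) where
  open BipartiteRealization

  union-adj : Vertex (suc d) k → Vertex (suc d) k → Bool
  union-adj (s , i) (t , j) with Fin.<-cmp s t
  ... | tri< s<t _ _ = edge (realize s<t) i j
  ... | tri≈ _ _ _   = false
  ... | tri> _ _ t<s = edge (realize t<s) j i

  union-symmetric : ∀ u v → union-adj u v ≡ union-adj v u
  union-symmetric (s , i) (t , j) with Fin.<-cmp s t | Fin.<-cmp t s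
  ... | tri< s<t _ _ | tri< _ _ s≮t  = ⊥-elim (s≮t s<t)
  ... | tri< s<t _ _ | tri≈ _ _ s≮t  = ⊥-elim (s≮t s<t)
  ... | tri< s<t _ _ | tri> _ _ s<t′ = cong (λ s<t → edge (realize s<t) i j) (Fin.<-irrelevant s<t s<t′)
  ... | tri≈ _ s≡t _ | tri< _ t≢s _  = ⊥-elim (t≢s (sym s≡t))
  ... | tri≈ _ _ _   | tri≈ _ _ _    = refl
  ... | tri≈ _ s≡t _ | tri> _ t≢s _  = ⊥-elim (t≢s (sym s≡t))
  ... | tri> _ _ t<s | tri< t<s′ _ _ = cong (λ t<s → edge (realize t<s) j i) (Fin.<-irrelevant t<s t<s′)
  ... | tri> _ _ t<s | tri≈ t≮s _ _  = ⊥-elim (t≮s t<s)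
  ... | tri> _ _ t<s | tri> t≮s _ _  = ⊥-elim (t≮s t<s)

  union-partite : ∀ u v → proj₁ u ≡ proj₁ v → union-adj u v ≡ false
  union-partite (s , i) (.s , j) refl with Fin.<-cmp s s
  ... | tri< s<s _ _ = ⊥-elim (Fin.<-irrefl refl s<s)
  ... | tri≈ _ _ _   = refl
  ... | tri> _ _ s<s = ⊥-elim (Fin.<-irrefl refl s<s)

  union : NPartiteGraph (suc d) k
  union = record { adj = union-adj ; symmetric = union-symmetric ; partite = union-partite }

  count-within : ∀ s i → count (λ j → union-adj (s , i) (s , j)) ≡ 0
  count-within s i = trans (sumFin-const (k s) λ j → cong bit (union-partite (s , i) (s , j) refl))
                           (*-zeroʳ (k s))

  count-across : ∀ s i t → t ≢ s → count (λ j → union-adj (s , i) (t , j)) ≡ f s i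
  count-across s i t t≢s with Fin.<-cmp s t
  ... | tri< s<t _ _ = row-degree (realize s<t) i
  ... | tri≈ _ s≡t _ = ⊥-elim (t≢s (sym s≡t))
  ... | tri> _ _ t<s = col-degree (realize t<s) i

  degree-union : ∀ s i → degree union (s , i) ≡ d * f s i
  degree-union s i =
    sumFin-except (λ t → count (λ j → union-adj (s , i) (t , j))) s (count-within s i) (count-across s i)

theorem3p1 : (n : ℕ) → (n≥2 : 2 ≤ n) → (k : Fin n → ℕ) → (∀ s → 1 ≤ k s)
    → (a b : (s : Fin n) → Fin (k s) → ℕ)
    → (∀ s i → a s i ≤ b s i)
    → (∀ s (i j : Fin (k s)) → toℕ i ≤ toℕ j → a s j ≤ a s i)
    → (∀ (m : Fin n) (r : ℕ) → 1 ≤ r → r ≤ k m → (s : Fin n) → ¬ (s ≡ m)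
        → sumFirst (k m) r (λ i → ⌈_/_⌉ (a m i) (n ∸ 1) {{nz n≥2}})
          ≤ sumFin (k s) (λ j → ⌊_/_⌋ (a s j) (n ∸ 1) {{nz n≥2}} ⊓ r))
    → Σ (NPartiteGraph n k) (λ G →
        ∀ (s : Fin n) (i : Fin (k s)) →
          (a s i ≤ degree G (s , i)) × (degree G (s , i) ≤ b s i))
theorem3p1 (suc (suc d′)) (s≤s (s≤s z≤n)) k _ a b a≤b a-antitone cond =
  union ⌊a⌋ realize , λ s i →
    ≤-reflexive (sym (degree≡a s i)) , ≤-trans (≤-reflexive (degree≡a s i)) (a≤b s i)
  where
  d = suc d′
  ⌊a⌋ ⌈a⌉ : (s : Fin (suc d)) → Fin (k s) → ℕ
  ⌊a⌋ s i = ⌊ a s i / d ⌋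
  ⌈a⌉ s i = ⌈ a s i / d ⌉
  ⌊a⌋≤⌈a⌉ : ∀ s i → ⌊a⌋ s i ≤ ⌈a⌉ s i
  ⌊a⌋≤⌈a⌉ s i = /-monoˡ-≤ d (m≤m+n (a s i) d′)
  condition : ∀ m s → s ≢ m → GaleRyser (⌈a⌉ m) (⌊a⌋ s)
  condition m s s≢m = GaleRyser-from-positive λ r 1≤r r≤k → cond m r 1≤r r≤k s s≢m
  Σ⌈a⌉≤Σ⌊a⌋ : ∀ m s → s ≢ m → sumFin (k m) (⌈a⌉ m) ≤ sumFin (k s) (⌊a⌋ s)
  Σ⌈a⌉≤Σ⌊a⌋ m s = GaleRyser⇒sumFin-≤ ∘ condition m s
  ⌊a⌋≡⌈a⌉ : ∀ s i → ⌊a⌋ s i ≡ ⌈a⌉ s i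
  ⌊a⌋≡⌈a⌉ s = squeeze ⌊a⌋≤⌈a⌉ Σ⌈a⌉≤Σ⌊a⌋ s (punchIn s zero , Fin.punchInᵢ≢i s zero)
  realize : ∀ {s t} → s Fin.< t → BipartiteRealization (⌊a⌋ s) (⌊a⌋ t)
  realize {s} {t} s<t = gale-ryser (/-monoˡ-≤ d ∘ a-antitone s _ _)
    (class-sums-≡ ⌊a⌋≤⌈a⌉ Σ⌈a⌉≤Σ⌊a⌋ s t t≢s)
    (GaleRyser-congˡ (sym ∘ ⌊a⌋≡⌈a⌉ s) (condition s t t≢s))
    where
    t≢s : t ≢ s
    t≢s t≡s = Fin.<-irrefl (sym t≡s) s<t
  degree≡a : ∀ s i → degree (union ⌊a⌋ realize) (s , i) ≡ a s i
  degree≡a s i = trans (degree-union ⌊a⌋ realize s i)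
                       (⌈/⌉≤⌊/⌋⇒exact (a s i) d′ (≤-reflexive (sym (⌊a⌋≡⌈a⌉ s i))))
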